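{- Let $G$ be a ribbon graph and $A\subseteq E(G)$. Then ${^\partial\varepsilon^{\times}_{G}(z)}={^\partial\varepsilon^{\times}_{G^{\times|A}}(z)}$.
   Context: A ribbon graph $G$ is a surface with boundary formed from vertex discs and edge discs (ribbons), each edge attached to vertex discs along two disjoint arcs; $v,e,f,c$ denote the numbers of vertices, edges, boundary components and connected components, and the Euler genus is $\varepsilon=2c-v+e-f$. For $A\subseteq E(G)$, the partial Petrial $G^{\times|A}$ is obtained from $G$ by adding a half-twist to each edge in $A$, and the partial Petrial polynomial is ${^\partial\varepsilon^{\times}_{G}(z)}=\sum_{A\subseteq E(G)} z^{\varepsilon(G^{\times|A})}$. -}

module Defs where

open import Data.Bool using (Bool; true; false; _∨_; _xor_; not; if_then_else_)
open import Data.Nat using (ℕ; zero; suc; _*_)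
open import Data.Fin using (Fin; zero; suc; toℕ; remQuot; combine)
open import Data.Fin.Properties using (_≟_)
open import Data.Integer as ℤ using (ℤ; +_)
open import Data.List using (List; []; _∷_; map; filter; length; _++_)
open import Data.Bool.ListAction using (any)
open import Data.List.Base using ()
open import Data.Vec using (Vec; []; _∷_; lookup)
open import Data.Fin.Subset using (Subset)
open import Data.Product using (_×_; _,_)
open import Relation.Binary.PropositionalEquality using (_≡_; _≢_)
open import Relation.Nullary using (does)
open import Relation.Nullary.Decidable using (⌊_⌋)
import Data.List as L
import Data.Nat as N

conn : ∀ {n} → List (Fin n → Fin n) → ℕ → Fin n → Fin n → Bool
conn gs zero    x y = ⌊ x ≟ y ⌋
conn gs (suc k) x y = conn gs k x y ∨ any (λ g → conn gs k (g x) y) gs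

isOrbitMin : ∀ {n} → List (Fin n → Fin n) → Fin n → Bool
isOrbitMin {n} gs x =
  not (any (λ y → ⌊ toℕ y N.<? toℕ x ⌋ Data.Bool.∧ conn gs n y x) (L.allFin n))
  where import Data.Bool

-- number of orbits of the group generated by gs (gs involutions)
orbits : ∀ {n} → List (Fin n → Fin n) → ℕ
orbits {n} gs = length (filter (λ x → isOrbitMin gs x ≟B true) (L.allFin n))
  where
  open import Data.Bool.Properties renaming (_≟_ to _≟B_)

-- Ribbon graphs, encoded by flags (graph-encoded maps).
-- Each edge i has four flags (i , l) with l : Fin 4 encoding
-- (end , side):  0 = (end 0, side 0), 1 = (end 0, side 1),
--                2 = (end 1, side 0), 3 = (end 1, side 1).
-- α : swap the side at the same end (crosses the edge-end attachment arc).
-- β : go along a side of the ribbon to the other end, same side label.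
-- αβ : go along the ribbon to the other end, switching side label.
-- τ : the arcs of the vertex boundaries between consecutive edge ends.
-- An edge is twisted iff its side arcs connect via αβ rather than β.
-- Isolated vertices (no incident edges) carry no flags and are counted
-- separately by nIso.

swapSide : Fin 4 → Fin 4
swapSide zero = suc zero
swapSide (suc zero) = zero
swapSide (suc (suc zero)) = suc (suc (suc zero))
swapSide (suc (suc (suc zero))) = suc (suc zero)

swapEnd : Fin 4 → Fin 4
swapEnd zero = suc (suc zero)
swapEnd (suc zero) = suc (suc (suc zero))
swapEnd (suc (suc zero)) = zero
swapEnd (suc (suc (suc zero))) = suc zero

record RibbonGraph : Set where
  field
    nE    : ℕ
    nIso  : ℕ
    τ     : Fin (nE * 4) → Fin (nE * 4)
    τ-inv : ∀ x → τ (τ x) ≡ x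
    τ-fpf : ∀ x → τ x ≢ x
    twisted : Fin nE → Bool

Flag : RibbonGraph → Set
Flag G = Fin (RibbonGraph.nE G * 4)

E : RibbonGraph → Set
E G = Fin (RibbonGraph.nE G)

αF : (G : RibbonGraph) → Flag G → Flag G
αF G x with remQuot {RibbonGraph.nE G} 4 x
... | i , l = combine i (swapSide l)

βF : (G : RibbonGraph) → Flag G → Flag G
βF G x with remQuot {RibbonGraph.nE G} 4 x
... | i , l = combine i (swapEnd l)

σF : (G : RibbonGraph) → Flag G → Flag G
σF G x with remQuot {RibbonGraph.nE G} 4 x
... | i , l = combine i (if RibbonGraph.twisted G i then swapSide (swapEnd l) else swapEnd l)

#v #e #f #c : RibbonGraph → ℕ
#v G = orbits (αF G ∷ RibbonGraph.τ G ∷ []) N.+ RibbonGraph.nIso G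
#e G = RibbonGraph.nE G
#f G = orbits (σF G ∷ RibbonGraph.τ G ∷ []) N.+ RibbonGraph.nIso G
#c G = orbits (αF G ∷ βF G ∷ RibbonGraph.τ G ∷ []) N.+ RibbonGraph.nIso G

eulerGenus : RibbonGraph → ℤ
eulerGenus G = ((+ (2 N.* #c G) ℤ.- + #v G) ℤ.+ + #e G) ℤ.- + #f G

partialPetrial : (G : RibbonGraph) → Subset (RibbonGraph.nE G) → RibbonGraph
partialPetrial G A = record
  { nE = nE ; nIso = nIso ; τ = τ ; τ-inv = τ-inv ; τ-fpf = τ-fpf
  ; twisted = λ i → twisted i xor lookup A i }
  where open RibbonGraph G

allSubsets : (m : ℕ) → List (Subset m)
allSubsets zero = [] ∷ []
allSubsets (suc m) = map (true ∷_) (allSubsets m) ++ map (false ∷_) (allSubsets m)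

-- The partial Petrial polynomial  Σ_{A ⊆ E(G)} z^{ε(G^{×|A})},
-- represented by its coefficient function: coefficient of z^j is the
-- number of A ⊆ E(G) with ε(G^{×|A}) = j.
partialPetrialPoly : RibbonGraph → ℤ → ℕ
partialPetrialPoly G j =
  length (filter (λ A → eulerGenus (partialPetrial G A) ℤ.≟ j)
                 (allSubsets (RibbonGraph.nE G)))

-- Half-twists add modulo 2 on each edge, so (G^{×|A})^{×|B} has the Euler genus
-- of G^{×|A △ B}. Summing over B ⊆ E(G) thus sums over A △ B, and B ↦ A △ B
-- permutes the subsets of E(G).
module Submission where

open import Defs
open import Data.Bool using (Bool; true; false; not; _∧_; _∨_; _xor_)
open import Data.Bool.Properties using (xor-assoc)
import Data.Bool.Properties as Bool
open import Data.Bool.ListAction using (or)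
open import Data.Fin using (Fin; remQuot)
open import Data.Fin.Subset using (Subset)
open import Data.Integer using (ℤ)
import Data.Integer as ℤ
open import Data.List using (List; []; _∷_; map; filter; length; _++_; allFin)
open import Data.List.Properties using (map-cong; map-∘; map-++; filter-≐)
open import Data.List.Relation.Binary.Pointwise as Pointwise using (Pointwise; []; _∷_; Pointwise-≡⇒≡)
open import Data.List.Relation.Binary.Permutation.Propositional using (_↭_; ↭-refl; module PermutationReasoning)
open import Data.List.Relation.Binary.Permutation.Propositional.Properties using (↭-length; filter-↭; map⁺; ++⁺; ++-comm)
open import Data.Nat using (ℕ; suc; _+_) renaming (_*_ to _ℕ*_)
open import Data.Product using (_,_; proj₁)
open import Data.Vec using ([]; _∷_; lookup; zipWith)
open import Data.Vec.Properties using (lookup-zipWith)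
open import Function using (_∘_)
open import Level using (Level)
open import Relation.Binary.Definitions using (DecidableEquality)
open import Relation.Binary.PropositionalEquality using (_≡_; _≗_; refl; sym; trans; cong; cong₂; module ≡-Reasoning)
open import Relation.Nullary using (does)
open import Relation.Unary using (Pred; Decidable)

private
  variable
    a p : Level
    A B : Set a
    n : ℕ

filter-≟-cong : (_≟_ : DecidableEquality B) {f g : A → B} → f ≗ g →
                ∀ y → filter (λ x → f x ≟ y) ≗ filter (λ x → g x ≟ y)
filter-≟-cong _≟_ f≗g y = filter-≐ _ _ ((λ {x} → trans (sym (f≗g x))) , (λ {x} → trans (f≗g x)))

length-filter-map : {P : Pred B p} (P? : Decidable P) (f : A → B) (xs : List A) →
                    length (filter P? (map f xs)) ≡ length (filter (P? ∘ f) xs)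
length-filter-map P? f [] = refl
length-filter-map P? f (x ∷ xs) with does (P? (f x))
... | true  = cong suc (length-filter-map P? f xs)
... | false = length-filter-map P? f xs

conn-cong : {fs gs : List (Fin n → Fin n)} → Pointwise _≗_ fs gs →
            ∀ k x y → conn fs k x y ≡ conn gs k x y
conn-cong fs≗gs 0       x y = refl
conn-cong fs≗gs (suc k) x y =
  cong₂ _∨_ (conn-cong fs≗gs k x y)
            (cong or (Pointwise-≡⇒≡ (Pointwise.map⁺ _ _ (Pointwise.map step fs≗gs))))
  where
  step : ∀ {f g} → f ≗ g → conn _ k (f x) y ≡ conn _ k (g x) y
  step {g = g} f≗g = trans (cong (λ z → conn _ k z y) (f≗g x)) (conn-cong fs≗gs k (g x) y)

orbits-cong : {fs gs : List (Fin n → Fin n)} → Pointwise _≗_ fs gs → orbits fs ≡ orbits gs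
orbits-cong {n} fs≗gs = cong length (filter-≟-cong Bool._≟_ isOrbitMin-cong true (allFin n))
  where
  isOrbitMin-cong : ∀ x → isOrbitMin _ x ≡ isOrbitMin _ x
  isOrbitMin-cong x =
    cong (not ∘ or) (map-cong (λ y → cong (_ ∧_) (conn-cong fs≗gs n y x)) (allFin n))

retwist : (G : RibbonGraph) → (E G → Bool) → RibbonGraph
retwist G t = record { nE = nE ; nIso = nIso ; τ = τ ; τ-inv = τ-inv ; τ-fpf = τ-fpf ; twisted = t }
  where open RibbonGraph G

module _ (G : RibbonGraph) {t t′ : E G → Bool} (t≗t′ : t ≗ t′) where

  σF-retwist-cong : σF (retwist G t) ≗ σF (retwist G t′)
  σF-retwist-cong x rewrite t≗t′ (proj₁ (remQuot {RibbonGraph.nE G} 4 x)) = refl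

  #f-retwist-cong : #f (retwist G t) ≡ #f (retwist G t′)
  #f-retwist-cong = cong (_+ RibbonGraph.nIso G) (orbits-cong (σF-retwist-cong ∷ (λ _ → refl) ∷ []))

  -- #v, #e and #c of retwist G t do not mention t, so they agree definitionally.
  eulerGenus-retwist-cong : eulerGenus (retwist G t) ≡ eulerGenus (retwist G t′)
  eulerGenus-retwist-cong =
    cong (λ f → ((ℤ.+ (2 ℕ* #c G) ℤ.- ℤ.+ #v G) ℤ.+ ℤ.+ #e G) ℤ.- ℤ.+ f) #f-retwist-cong

_△_ : Subset n → Subset n → Subset n
_△_ = zipWith _xor_

eulerGenus-partialPetrial-△ : (G : RibbonGraph) (A B : Subset (#e G)) →
                   eulerGenus (partialPetrial (partialPetrial G A) B) ≡ eulerGenus (partialPetrial G (A △ B))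
eulerGenus-partialPetrial-△ G A B = eulerGenus-retwist-cong G λ i → begin
  (twisted i xor lookup A i) xor lookup B i  ≡⟨ xor-assoc (twisted i) _ _ ⟩
  twisted i xor (lookup A i xor lookup B i)  ≡⟨ cong (twisted i xor_) (lookup-zipWith _xor_ i A B) ⟨
  twisted i xor lookup (A △ B) i             ∎
  where
  open RibbonGraph G
  open ≡-Reasoning

map-△-cons : (x y : Bool) (A : Subset n) (Bs : List (Subset n)) →
             map ((x ∷ A) △_) (map (y ∷_) Bs) ≡ map ((x xor y) ∷_) (map (A △_) Bs)
map-△-cons x y A Bs = trans (sym (map-∘ Bs)) (map-∘ Bs)

map-△-allSubsets : (A : Subset n) → map (A △_) (allSubsets n) ↭ allSubsets n
map-△-allSubsets {0}     []      = ↭-refl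
map-△-allSubsets {suc n} (x ∷ A) = begin
  map ((x ∷ A) △_) (map (true ∷_) S ++ map (false ∷_) S)
    ≡⟨ map-++ _ (map (true ∷_) S) _ ⟩
  map ((x ∷ A) △_) (map (true ∷_) S) ++ map ((x ∷ A) △_) (map (false ∷_) S)
    ≡⟨ cong₂ _++_ (map-△-cons x true A S) (map-△-cons x false A S) ⟩
  map ((x xor true) ∷_) (map (A △_) S) ++ map ((x xor false) ∷_) (map (A △_) S)
    ↭⟨ ++⁺ (map⁺ _ (map-△-allSubsets A)) (map⁺ _ (map-△-allSubsets A)) ⟩
  map ((x xor true) ∷_) S ++ map ((x xor false) ∷_) S
    ↭⟨ swap-halves x ⟩
  map (true ∷_) S ++ map (false ∷_) S
    ∎
  where
  open PermutationReasoning
  S = allSubsets n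
  swap-halves : ∀ c → map ((c xor true) ∷_) S ++ map ((c xor false) ∷_) S ↭ map (true ∷_) S ++ map (false ∷_) S
  swap-halves false = ↭-refl
  swap-halves true  = ++-comm (map (false ∷_) S) _

length-filter-allSubsets-△ : {P : Pred (Subset n) p} (P? : Decidable P) (A : Subset n) →
                             length (filter P? (allSubsets n)) ≡ length (filter (P? ∘ (A △_)) (allSubsets n))
length-filter-allSubsets-△ {n} P? A = begin
  length (filter P? (allSubsets n))                  ≡⟨ ↭-length (filter-↭ P? (map-△-allSubsets A)) ⟨
  length (filter P? (map (A △_) (allSubsets n)))     ≡⟨ length-filter-map P? (A △_) (allSubsets n) ⟩
  length (filter (P? ∘ (A △_)) (allSubsets n))       ∎
  where open ≡-Reasoning

lemma2p3 : (G : RibbonGraph) (A : Subset (RibbonGraph.nE G)) →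
    ∀ (j : ℤ) → partialPetrialPoly G j ≡ partialPetrialPoly (partialPetrial G A) j
lemma2p3 G A j = begin
  partialPetrialPoly G j
    ≡⟨ length-filter-allSubsets-△ (λ C → eulerGenus (partialPetrial G C) ℤ.≟ j) A ⟩
  length (filter (λ B → eulerGenus (partialPetrial G (A △ B)) ℤ.≟ j) (allSubsets (#e G)))
    ≡⟨ cong length (filter-≟-cong ℤ._≟_ (sym ∘ eulerGenus-partialPetrial-△ G A) j (allSubsets (#e G))) ⟩
  partialPetrialPoly (partialPetrial G A) j
    ∎
  where open ≡-Reasoning
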